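{- Let $n$ be a positive integer and $m$ a positive divisor of $n$. Let $c,d\in\mathbb Z$ with $0\le c<d$ and $\gcd(c,d)=1$, and let $\delta=\gcd(m,d)$. Put $n'=n/\delta$, $m'=m/\delta$, $d'=d/\delta$. Then $$\#\left\{(r,j):\ r\mid n,\ 0\le j\le r-1,\ m=\gcd\!\left(\tfrac nr c+jd,\ rd\right)\right\}=\sum_{\substack{m'\mid r\mid n'\\ \gcd(n/r,\,d)=\delta}}(r/m')_{d'}\,\phi\big((r/m')_{d'}^{\perp}\big),$$ where $r$ runs over positive integers and $\phi$ is Euler's totient function.
   Context: For positive integers $x,e$, $(x)_e=\prod_{p\mid x,\,p\mid e}p^{v_p(x)}$ (the $e$-part of $x$) and $(x)_e^{\perp}=\prod_{p\mid x,\,p\nmid e}p^{v_p(x)}$ (the $e$-free part of $x$), where $p$ runs over primes and $v_p(x)$ is the exponent of $p$ in $x$. -}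

module Defs where

open import Data.Nat using (ℕ; zero; suc; _+_; _*_; _^_; _≟_; NonZero)
open import Data.Nat.Divisibility using (_∣_; _∣?_)
open import Data.Nat.DivMod using (_/_; _%_)
open import Data.Nat.GCD using (gcd)
open import Data.Nat.Primality using (Prime; prime?)
open import Data.List using (List; []; _∷_; filter; map; length; upTo; concatMap)
open import Data.Nat.ListAction using (sum; product)
open import Data.Product using (_×_; _,_; proj₁; proj₂)
open import Relation.Nullary.Decidable using (Dec; yes; no; _×-dec_; ¬?)
open import Relation.Unary using (Pred)

range1 : ℕ → List ℕ
range1 n = map suc (upTo n)

-- v_p(x): exponent of p in x, computed with fuel x (enough for x ≥ 1, p ≥ 2).
-- Convention: only used for primes p and x ≥ 1.
vp-fuel : ℕ → (p x : ℕ) → ℕ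
vp-fuel zero    p x = 0
vp-fuel (suc k) zero x = 0
vp-fuel (suc k) (suc p) x with suc p ∣? x
... | yes _ = suc (vp-fuel k (suc p) (x / suc p))
... | no  _ = 0

v : (p x : ℕ) → ℕ
v p x = vp-fuel x p x

-- primes dividing x (for x ≥ 1 all such primes are ≤ x)
primeDivisors : ℕ → List ℕ
primeDivisors x = filter (λ p → prime? p ×-dec (p ∣? x)) (range1 x)

ePart : (x e : ℕ) → ℕ
ePart x e = product (map (λ p → p ^ v p x) (filter (λ p → p ∣? e) (primeDivisors x)))

eFreePart : (x e : ℕ) → ℕ
eFreePart x e = product (map (λ p → p ^ v p x) (filter (λ p → ¬? (p ∣? e)) (primeDivisors x)))

φ : ℕ → ℕ
φ k = length (filter (λ i → gcd i k ≟ 1) (range1 k))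

divisors : ℕ → List ℕ
divisors n = filter (λ r → r ∣? n) (range1 n)

-- Left-hand side: #{(r,j) : r ∣ n, 0 ≤ j ≤ r-1, m = gcd((n/r)c + j d, r d)}
-- (all divisors r of n are positive, so n / r is well-defined; we use a
--  total division returning 0 for r = 0, which never occurs here)
_div_ : ℕ → ℕ → ℕ
a div zero = 0
a div suc b = a / suc b

lhsCount : (n m c d : ℕ) → ℕ
lhsCount n m c d =
  length (filter (λ rj → m ≟ gcd ((n div (proj₁ rj)) * c + proj₂ rj * d)
                                 (proj₁ rj * d))
                 (concatMap (λ r → map (λ j → r , j) (upTo r)) (divisors n)))

rhsSum : (n m c d : ℕ) → ℕ
rhsSum n m c d =
  let δ  = gcd m d
      n' = n div δ
      m' = m div δ
      d' = d div δ
  in sum (map (λ r → ePart (r div m') d' * φ (eFreePart (r div m') d'))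
              (filter (λ r → (m' ∣? r) ×-dec (gcd (n div r) d ≟ δ)) (divisors n')))

module Submission where

-- For a fixed divisor r of n write a = n/r.  Since c is coprime to d, the
-- gcd of  a·c + j·d  and  r·d  meets d exactly in gcd (a , d); so no j
-- contributes unless gcd (a , d) = δ.  In that case dividing everything
-- by δ turns the condition into  m′ = gcd (s + j·d′ , r·d′)  with s = a′·c
-- coprime to d′, which forces m′ ∣ r.  Writing r = m′·A·B with A = (r/m′)_{d′}
-- and B = (r/m′)^⊥_{d′}, the factor A·d′ can be dropped from the modulus, the
-- condition becomes periodic in j with period C = m′·B, and on one period
-- j ↦ (s + j·d′) mod C permutes the residues mod C; the residues y with
-- gcd (y , m′B) = m′ are the m′·i with gcd (i , B) = 1, giving A·φ(B).
-- Summing over the divisors r of n (the contributing ones divide n′) gives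
-- the theorem.

open import Defs
open import Data.Nat using (ℕ; _<_; _≤_)
open import Data.Nat.Divisibility using (_∣_)
open import Data.Nat.GCD using (gcd)
open import Relation.Binary.PropositionalEquality using (_≡_)

open import Data.Nat as ℕ using (zero; suc; _+_; _*_; _^_; _∸_; _≟_; NonZero; z≤n; s≤s; s≤s⁻¹)
open import Data.Nat.Properties
open import Data.Nat.Divisibility
  using (divides; _∣?_; ∣-trans; ∣m∣n⇒∣m+n; ∣m+n∣m⇒∣n; ∣n⇒∣m*n; ∣m⇒∣m*n; n∣m*n; m∣m*n; ∣⇒≤; ∣1⇒≡1; 1∣_; 0∣⇒≡0;
         *-monoʳ-∣; *-cancelˡ-∣)
open import Data.Nat.DivMod using (_%_; _/_; m≡m%n+[m/n]*n; m%n<n; m*[n/m]≡n; m/n<m)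
open import Data.Nat.GCD
  using (gcd-universality; gcd-greatest; gcd[m,n]∣m; gcd[m,n]∣n; c*gcd[m,n]≡gcd[cm,cn]; gcd-identityˡ;
         gcd[m,n]≡0⇒m≡0)
open import Data.Nat.Coprimality using (Coprime; coprime-divisor; gcd≡1⇒coprime; 1-coprimeTo)
import Data.Nat.Coprimality as Coprime
open import Data.Nat.Primality using (Prime; prime?; prime⇒irreducible; prime⇒nonTrivial; productOfPrimes≥1)
open import Data.Nat.Primality.Factorisation using (factorise; PrimeFactorisation)
open import Data.Nat.ListAction using (sum; product)
open import Data.Nat.Solver using (module +-*-Solver)
open +-*-Solver using (solve; _:+_; _:*_; _:=_)
open import Data.List using (List; []; _∷_; _++_; filter; map; length; upTo; concatMap; applyUpTo)
open import Data.List.Properties using (map-upTo; map-cong; length-++; filter-++)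
open import Data.List.Relation.Unary.All as All using (All; []; _∷_)
open import Data.List.Relation.Unary.All.Properties using (all-filter; filter⁺)
open import Data.Product using (_×_; _,_; proj₁; proj₂)
open import Data.Sum using (_⊎_; inj₁; inj₂; [_,_]′)
open import Function using (_∘_)
open import Relation.Nullary using (¬_; Dec; yes; no; contradiction)
open import Relation.Nullary.Decidable using (_×-dec_; ¬?)
open import Relation.Unary using (Pred; Decidable)
open import Relation.Binary using (tri<; tri≈; tri>)
open import Relation.Binary.PropositionalEquality
  using (_≢_; refl; sym; trans; cong; cong₂; subst; subst₂; module ≡-Reasoning)

∑ : (ℕ → ℕ) → ℕ → ℕ
∑ f zero    = 0
∑ f (suc n) = f 0 + ∑ (f ∘ suc) n

∑-cong : ∀ n {f g : ℕ → ℕ} → (∀ i → i < n → f i ≡ g i) → ∑ f n ≡ ∑ g n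
∑-cong zero    eq = refl
∑-cong (suc n) eq = cong₂ _+_ (eq 0 (s≤s z≤n)) (∑-cong n (λ i i<n → eq (suc i) (s≤s i<n)))

∑-zero : ∀ n {f : ℕ → ℕ} → (∀ i → i < n → f i ≡ 0) → ∑ f n ≡ 0
∑-zero zero    eq = refl
∑-zero (suc n) eq = cong₂ _+_ (eq 0 (s≤s z≤n)) (∑-zero n (λ i i<n → eq (suc i) (s≤s i<n)))

∑-+ : ∀ a b (f : ℕ → ℕ) → ∑ f (a + b) ≡ ∑ f a + ∑ (λ i → f (a + i)) b
∑-+ zero    b f = refl
∑-+ (suc a) b f = trans (cong (f 0 +_) (∑-+ a b (f ∘ suc))) (sym (+-assoc (f 0) _ _))

∑-last : ∀ n (f : ℕ → ℕ) → ∑ f (suc n) ≡ ∑ f n + f n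
∑-last n f = begin
  ∑ f (suc n)             ≡⟨ cong (∑ f) (+-comm 1 n) ⟩
  ∑ f (n + 1)             ≡⟨ ∑-+ n 1 f ⟩
  ∑ f n + (f (n + 0) + 0) ≡⟨ cong (λ z → ∑ f n + z) (trans (+-identityʳ _) (cong f (+-identityʳ n))) ⟩
  ∑ f n + f n             ∎
  where open ≡-Reasoning

∑-rotate : ∀ n (f : ℕ → ℕ) → f 0 ≡ f n → ∑ f n ≡ ∑ (f ∘ suc) n
∑-rotate n f eq = +-cancelʳ-≡ (f n) _ _ (begin
  ∑ f n + f n         ≡⟨ sym (∑-last n f) ⟩
  f 0 + ∑ (f ∘ suc) n ≡⟨ +-comm (f 0) _ ⟩
  ∑ (f ∘ suc) n + f 0 ≡⟨ cong (∑ (f ∘ suc) n +_) eq ⟩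
  ∑ (f ∘ suc) n + f n ∎)
  where open ≡-Reasoning

∑-distrib-+ : ∀ n (f g : ℕ → ℕ) → ∑ (λ i → f i + g i) n ≡ ∑ f n + ∑ g n
∑-distrib-+ zero    f g = refl
∑-distrib-+ (suc n) f g =
  trans (cong (f 0 + g 0 +_) (∑-distrib-+ n (f ∘ suc) (g ∘ suc))) (interchange (f 0) (g 0) _ _)
  where
  interchange : ∀ a b c e → (a + b) + (c + e) ≡ (a + c) + (b + e)
  interchange = solve 4 (λ a b c e → (a :+ b) :+ (c :+ e) := (a :+ c) :+ (b :+ e)) refl

∑-*ʳ : ∀ n (f : ℕ → ℕ) k → ∑ (λ i → f i * k) n ≡ ∑ f n * k
∑-*ʳ zero    f k = refl
∑-*ʳ (suc n) f k = trans (cong (f 0 * k +_) (∑-*ʳ n (f ∘ suc) k)) (sym (*-distribʳ-+ k (f 0) _))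

∑-comm : ∀ n m (h : ℕ → ℕ → ℕ) → ∑ (λ i → ∑ (h i) m) n ≡ ∑ (λ j → ∑ (λ i → h i j) n) m
∑-comm zero    m h = sym (∑-zero m (λ _ _ → refl))
∑-comm (suc n) m h = trans (cong (∑ (h 0) m +_) (∑-comm n m (h ∘ suc)))
                           (sym (∑-distrib-+ m (h 0) (λ j → ∑ (λ i → h (suc i) j) n)))

∑-periodic : ∀ q C (f : ℕ → ℕ) → (∀ j → f (C + j) ≡ f j) → ∑ f (q * C) ≡ q * ∑ f C
∑-periodic zero    C f per = refl
∑-periodic (suc q) C f per = trans (∑-+ C (q * C) f)
  (cong (∑ f C +_) (trans (∑-cong (q * C) (λ i _ → per i)) (∑-periodic q C f per)))

∑-blocks : ∀ q C (f : ℕ → ℕ) → ∑ f (q * C) ≡ ∑ (λ i → ∑ (λ t → f (i * C + t)) C) q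
∑-blocks zero    C f = refl
∑-blocks (suc q) C f = trans (∑-+ C (q * C) f)
  (cong (∑ f C +_) (trans (∑-blocks q C (λ i → f (C + i)))
    (∑-cong q (λ i _ → ∑-cong C (λ t _ → cong f (sym (+-assoc C (i * C) t)))))))

∑-≤ : ∀ n (f : ℕ → ℕ) → (∀ i → i < n → f i ≤ 1) → ∑ f n ≤ n
∑-≤ zero    f h = z≤n
∑-≤ (suc n) f h = +-mono-≤ (h 0 (s≤s z≤n)) (∑-≤ n (f ∘ suc) (λ i i<n → h (suc i) (s≤s i<n)))

-- Conditional values: `select d k e` is k if the decision d is positive and
-- e otherwise.  With e = 0 it is a summand of a filtered sum, with e = 1 a
-- factor of a filtered product.

select : ∀ {p} {P : Set p} → Dec P → ℕ → ℕ → ℕ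
select (yes _) k e = k
select (no _)  k e = e

𝟙 : ∀ {p} {P : Set p} → Dec P → ℕ
𝟙 d = select d 1 0

select-yes : ∀ {p} {P : Set p} (d : Dec P) {k e} → P → select d k e ≡ k
select-yes (yes _)  _ = refl
select-yes (no ¬p)  p = contradiction p ¬p

select-no : ∀ {p} {P : Set p} (d : Dec P) {k e} → ¬ P → select d k e ≡ e
select-no (yes p) ¬p = contradiction p ¬p
select-no (no _)  _  = refl

select-⇔ : ∀ {p q} {P : Set p} {Q : Set q} (d : Dec P) (d′ : Dec Q) {k e} →
  (P → Q) → (Q → P) → select d k e ≡ select d′ k e
select-⇔ (yes p) d′ f g = sym (select-yes d′ (f p))
select-⇔ (no ¬p) d′ f g = sym (select-no d′ (λ q → ¬p (g q)))

select-const : ∀ {p} {P : Set p} (d : Dec P) {k} → select d k k ≡ k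
select-const (yes _) = refl
select-const (no _)  = refl

sum-filter : ∀ {a p} {A : Set a} {P : Pred A p} (P? : Decidable P) (h : A → ℕ) xs →
  sum (map h (filter P? xs)) ≡ sum (map (λ x → select (P? x) (h x) 0) xs)
sum-filter P? h [] = refl
sum-filter P? h (x ∷ xs) with P? x
... | yes _ = cong (h x +_) (sum-filter P? h xs)
... | no _  = sum-filter P? h xs

product-filter : ∀ {a p} {A : Set a} {P : Pred A p} (P? : Decidable P) (h : A → ℕ) xs →
  product (map h (filter P? xs)) ≡ product (map (λ x → select (P? x) (h x) 1) xs)
product-filter P? h [] = refl
product-filter P? h (x ∷ xs) with P? x
... | yes _ = cong (h x *_) (product-filter P? h xs)
... | no _  = trans (product-filter P? h xs) (sym (*-identityˡ _))

length≡sum : ∀ {a} {A : Set a} (xs : List A) → length xs ≡ sum (map (λ _ → 1) xs)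
length≡sum []       = refl
length≡sum (x ∷ xs) = cong suc (length≡sum xs)

sum-applyUpTo : ∀ {a} {A : Set a} (h : A → ℕ) (g : ℕ → A) n → sum (map h (applyUpTo g n)) ≡ ∑ (h ∘ g) n
sum-applyUpTo h g zero    = refl
sum-applyUpTo h g (suc n) = cong (h (g 0) +_) (sum-applyUpTo h (g ∘ suc) n)

sum-filter-range1 : ∀ {p} {P : Pred ℕ p} (P? : Decidable P) (h : ℕ → ℕ) N →
  sum (map h (filter P? (range1 N))) ≡ ∑ (λ i → select (P? (suc i)) (h (suc i)) 0) N
sum-filter-range1 P? h N = begin
  sum (map h (filter P? (range1 N)))                       ≡⟨ sum-filter P? h (range1 N) ⟩
  sum (map (λ x → select (P? x) (h x) 0) (range1 N))        ≡⟨ cong (sum ∘ map _) (map-upTo suc N) ⟩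
  sum (map (λ x → select (P? x) (h x) 0) (applyUpTo suc N)) ≡⟨ sum-applyUpTo _ suc N ⟩
  ∑ (λ i → select (P? (suc i)) (h (suc i)) 0) N            ∎
  where open ≡-Reasoning

length-filter-concatMap : ∀ {a b p} {A : Set a} {B : Set b} {P : Pred B p} (P? : Decidable P) (F : A → List B) xs →
  length (filter P? (concatMap F xs)) ≡ sum (map (λ x → length (filter P? (F x))) xs)
length-filter-concatMap P? F [] = refl
length-filter-concatMap P? F (x ∷ xs) = begin
  length (filter P? (F x ++ concatMap F xs))
    ≡⟨ cong length (filter-++ P? (F x) (concatMap F xs)) ⟩
  length (filter P? (F x) ++ filter P? (concatMap F xs))
    ≡⟨ length-++ (filter P? (F x)) ⟩
  length (filter P? (F x)) + length (filter P? (concatMap F xs))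
    ≡⟨ cong (length (filter P? (F x)) +_) (length-filter-concatMap P? F xs) ⟩
  length (filter P? (F x)) + sum (map (λ x → length (filter P? (F x))) xs) ∎
  where open ≡-Reasoning

-- Reindexing a sum along an injection σ of [0, C) into itself.  Writing
-- H (σ j) = ∑_y [ σ j ≡? y ]·H y and exchanging the sums, each y < C is hit
-- by at most one j (injectivity) while C hits occur in total, so every y is
-- hit exactly once.

[_≡?_] : ℕ → ℕ → ℕ
[ x ≡? y ] = 𝟙 (x ≟ y)

[≡?]≤1 : ∀ x y → [ x ≡? y ] ≤ 1
[≡?]≤1 x y with x ≟ y
... | yes _ = ≤-refl
... | no _  = z≤n

[≡?]-pos : ∀ x y → 0 < [ x ≡? y ] → x ≡ y
[≡?]-pos x y pos with x ≟ y
... | yes x≡y = x≡y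
... | no _    = contradiction pos λ ()

∑-δ : ∀ C x (H : ℕ → ℕ) → x < C → ∑ (λ y → [ x ≡? y ] * H y) C ≡ H x
∑-δ (suc C) x H x<1+C = trans (∑-last C (λ y → [ x ≡? y ] * H y)) (last (x ≟ C))
  where
  last : Dec (x ≡ C) → ∑ (λ y → [ x ≡? y ] * H y) C + [ x ≡? C ] * H C ≡ H x
  last (yes refl) = begin
    ∑ (λ y → [ x ≡? y ] * H y) x + [ x ≡? x ] * H x
      ≡⟨ cong₂ _+_ (∑-zero x (λ y y<x → cong (_* H y) (select-no (x ≟ y) λ x≡y → <-irrefl (sym x≡y) y<x)))
                   (cong (_* H x) (select-yes (x ≟ x) refl)) ⟩
    0 + (H x + 0)
      ≡⟨ +-identityʳ (H x) ⟩
    H x ∎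
    where open ≡-Reasoning
  last (no x≢C) = trans (cong₂ _+_ (∑-δ C x H (≤∧≢⇒< (s≤s⁻¹ x<1+C) x≢C))
                                   (cong (_* H C) (select-no (x ≟ C) x≢C)))
                        (+-identityʳ (H x))

∑-≤1 : ∀ n (f : ℕ → ℕ) → (∀ i → f i ≤ 1) →
  (∀ i j → i < n → j < n → 0 < f i → 0 < f j → i ≡ j) → ∑ f n ≤ 1
∑-≤1 zero    f bound once = z≤n
∑-≤1 (suc n) f bound once = subst (_≤ 1) (sym (∑-last n f)) (withLast (f n) refl)
  where
  once′ : ∀ i j → i < n → j < n → 0 < f i → 0 < f j → i ≡ j
  once′ i j i<n j<n = once i j (m≤n⇒m≤1+n i<n) (m≤n⇒m≤1+n j<n)
  withLast : ∀ k → f n ≡ k → ∑ f n + k ≤ 1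
  withLast zero    _  = subst (_≤ 1) (sym (+-identityʳ _)) (∑-≤1 n f bound once′)
  withLast (suc k) fn = subst (λ s → s + suc k ≤ 1) (sym (∑-zero n others)) (subst (_≤ 1) fn (bound n))
    where
    others : ∀ i → i < n → f i ≡ 0
    others i i<n with f i in fi
    ... | zero  = refl
    ... | suc _ = contradiction
      (once i n (m≤n⇒m≤1+n i<n) ≤-refl (subst (0 <_) (sym fi) (s≤s z≤n)) (subst (0 <_) (sym fn) (s≤s z≤n)))
      (<⇒≢ i<n)

∑-saturated : ∀ n (f : ℕ → ℕ) → (∀ i → i < n → f i ≤ 1) → ∑ f n ≡ n → ∀ i → i < n → f i ≡ 1
∑-saturated (suc n) f bound total i i<1+n = atIndex (m<1+n⇒m<n∨m≡n i<1+n)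
  where
  bound′ : ∀ i → i < n → f i ≤ 1
  bound′ i i<n = bound i (m≤n⇒m≤1+n i<n)
  split : ∀ s k → s ≤ n → k ≤ 1 → s + k ≡ suc n → s ≡ n × k ≡ 1
  split s zero          s≤n _ eq = contradiction (subst (_≤ n) (trans (sym (+-identityʳ s)) eq) s≤n) (n≮n n)
  split s (suc zero)    _   _ eq = +-cancelʳ-≡ 1 s n (trans eq (+-comm 1 n)) , refl
  split s (suc (suc k)) _   (s≤s ()) _
  sum≡n×fn≡1 : ∑ f n ≡ n × f n ≡ 1
  sum≡n×fn≡1 = split (∑ f n) (f n) (∑-≤ n f bound′) (bound n ≤-refl) (trans (sym (∑-last n f)) total)
  atIndex : i < n ⊎ i ≡ n → f i ≡ 1
  atIndex (inj₁ i<n)  = ∑-saturated n f bound′ (proj₁ sum≡n×fn≡1) i i<n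
  atIndex (inj₂ refl) = proj₂ sum≡n×fn≡1

∑-reindex : ∀ C (σ H : ℕ → ℕ) → (∀ j → j < C → σ j < C) →
  (∀ i j → i < C → j < C → σ i ≡ σ j → i ≡ j) → ∑ (H ∘ σ) C ≡ ∑ H C
∑-reindex C σ H σ< injective = begin
  ∑ (H ∘ σ) C                                    ≡⟨ ∑-cong C (λ j j<C → sym (∑-δ C (σ j) H (σ< j j<C))) ⟩
  ∑ (λ j → ∑ (λ y → [ σ j ≡? y ] * H y) C) C      ≡⟨ ∑-comm C C (λ j y → [ σ j ≡? y ] * H y) ⟩
  ∑ (λ y → ∑ (λ j → [ σ j ≡? y ] * H y) C) C      ≡⟨ ∑-cong C (λ y _ → ∑-*ʳ C (λ j → [ σ j ≡? y ]) (H y)) ⟩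
  ∑ (λ y → hits y * H y) C                       ≡⟨ ∑-cong C (λ y y<C → trans (cong (_* H y) (hitOnce y y<C)) (*-identityˡ (H y))) ⟩
  ∑ H C                                          ∎
  where
  open ≡-Reasoning
  hits : ℕ → ℕ
  hits y = ∑ (λ j → [ σ j ≡? y ]) C
  hits≤1 : ∀ y → y < C → hits y ≤ 1
  hits≤1 y _ = ∑-≤1 C (λ j → [ σ j ≡? y ]) (λ j → [≡?]≤1 (σ j) y)
    (λ i j i<C j<C hi hj → injective i j i<C j<C (trans ([≡?]-pos _ _ hi) (sym ([≡?]-pos _ _ hj))))
  allHits : ∑ hits C ≡ C
  allHits = begin
    ∑ hits C                                    ≡⟨ ∑-comm C C (λ y j → [ σ j ≡? y ]) ⟩
    ∑ (λ j → ∑ (λ y → [ σ j ≡? y ]) C) C         ≡⟨ ∑-cong C (λ j j<C →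
                                                     trans (∑-cong C (λ y _ → sym (*-identityʳ [ σ j ≡? y ])))
                                                           (∑-δ C (σ j) (λ _ → 1) (σ< j j<C))) ⟩
    ∑ (λ _ → 1) C                               ≡⟨ ∑-ones C ⟩
    C                                           ∎
    where
    ∑-ones : ∀ n → ∑ (λ _ → 1) n ≡ n
    ∑-ones zero    = refl
    ∑-ones (suc n) = cong suc (∑-ones n)
  hitOnce : ∀ y → y < C → hits y ≡ 1
  hitOnce = ∑-saturated C hits hits≤1 allHits

gcd-cong-divisors : ∀ {a b a′ b′} → (∀ {k} → k ∣ a → k ∣ b → k ∣ a′ × k ∣ b′) →
  (∀ {k} → k ∣ a′ → k ∣ b′ → k ∣ a × k ∣ b) → gcd a b ≡ gcd a′ b′
gcd-cong-divisors {a} {b} to from = gcd-universality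
  (λ { (k∣a′ , k∣b′) → let k∣a , k∣b = from k∣a′ k∣b′ in gcd-greatest k∣a k∣b })
  (λ k∣g → to (∣-trans k∣g (gcd[m,n]∣m a b)) (∣-trans k∣g (gcd[m,n]∣n a b)))

gcd-self : ∀ n → gcd n n ≡ n
gcd-self n = sym (gcd-universality proj₁ (λ k∣n → k∣n , k∣n))

1≤gcd : ∀ m d → 1 ≤ m → 1 ≤ gcd m d
1≤gcd (suc m) d _ with gcd (suc m) d in g
... | zero  = contradiction (gcd[m,n]≡0⇒m≡0 {suc m} {d} g) λ ()
... | suc _ = s≤s z≤n

coprime-* : ∀ {a b e} → Coprime a e → Coprime b e → Coprime (a * b) e
coprime-* {a} {b} {e} a⊥e b⊥e {k} (k∣ab , k∣e) = b⊥e (coprime-divisor k⊥a k∣ab , k∣e)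
  where
  k⊥a : Coprime k a
  k⊥a (t∣k , t∣a) = a⊥e (t∣a , ∣-trans t∣k k∣e)

coprime-∣ˡ : ∀ {a e k} → Coprime a e → k ∣ a → Coprime k e
coprime-∣ˡ a⊥e k∣a (t∣k , t∣e) = a⊥e (∣-trans t∣k k∣a , t∣e)

coprime-∣ʳ : ∀ {a e k} → Coprime a e → k ∣ e → Coprime a k
coprime-∣ʳ a⊥e k∣e (t∣a , t∣k) = a⊥e (t∣a , ∣-trans t∣k k∣e)

coprime-^ : ∀ {a e} n → Coprime a e → Coprime (a ^ n) e
coprime-^ zero    _   = 1-coprimeTo _
coprime-^ (suc n) a⊥e = coprime-* a⊥e (coprime-^ n a⊥e)

gcd-shift : ∀ x u C → gcd (x + u * C) C ≡ gcd x C
gcd-shift x u C = gcd-cong-divisors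
  (λ {k} k∣x+uC k∣C → ∣m+n∣m⇒∣n (subst (k ∣_) (+-comm x (u * C)) k∣x+uC) (∣n⇒∣m*n u k∣C) , k∣C)
  (λ k∣x k∣C → ∣m∣n⇒∣m+n k∣x (∣n⇒∣m*n u k∣C) , k∣C)

gcd-% : ∀ x C .{{_ : NonZero C}} → gcd (x % C) C ≡ gcd x C
gcd-% x C = trans (sym (gcd-shift (x % C) (x / C) C)) (cong (λ z → gcd z C) (sym (m≡m%n+[m/n]*n x C)))

gcd-drop-coprime : ∀ y u v → Coprime y u → gcd y (u * v) ≡ gcd y v
gcd-drop-coprime y u v y⊥u = gcd-cong-divisors
  (λ k∣y k∣uv → k∣y , coprime-divisor (coprime-∣ˡ y⊥u k∣y) k∣uv)
  (λ k∣y k∣v → k∣y , ∣n⇒∣m*n u k∣v)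

%-shift⇒∣ : ∀ x u C .{{_ : NonZero C}} → (x + u) % C ≡ x % C → C ∣ u
%-shift⇒∣ x u C eq = ∣m+n∣m⇒∣n (subst (C ∣_) quotients (n∣m*n ((x + u) / C))) (n∣m*n (x / C))
  where
  open ≡-Reasoning
  quotients : (x + u) / C * C ≡ x / C * C + u
  quotients = +-cancelˡ-≡ (x % C) _ _ (begin
    x % C + (x + u) / C * C        ≡⟨ cong (_+ (x + u) / C * C) (sym eq) ⟩
    (x + u) % C + (x + u) / C * C  ≡⟨ sym (m≡m%n+[m/n]*n (x + u) C) ⟩
    x + u                          ≡⟨ cong (_+ u) (m≡m%n+[m/n]*n x C) ⟩
    x % C + x / C * C + u          ≡⟨ +-assoc (x % C) _ u ⟩
    x % C + (x / C * C + u)        ∎)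

gcd-gcd-coprime : ∀ a c d r j → Coprime c d → gcd (gcd (a * c + j * d) (r * d)) d ≡ gcd a d
gcd-gcd-coprime a c d r j c⊥d = gcd-cong-divisors to from
  where
  to : ∀ {k} → k ∣ gcd (a * c + j * d) (r * d) → k ∣ d → k ∣ a × k ∣ d
  to {k} k∣g k∣d = coprime-divisor (Coprime.sym (coprime-∣ʳ c⊥d k∣d)) k∣ca , k∣d
    where
    k∣jd+ac : k ∣ j * d + a * c
    k∣jd+ac = subst (k ∣_) (+-comm (a * c) (j * d)) (∣-trans k∣g (gcd[m,n]∣m _ _))
    k∣ca : k ∣ c * a
    k∣ca = subst (k ∣_) (*-comm a c) (∣m+n∣m⇒∣n k∣jd+ac (∣n⇒∣m*n j k∣d))
  from : ∀ {k} → k ∣ a → k ∣ d → k ∣ gcd (a * c + j * d) (r * d) × k ∣ d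
  from k∣a k∣d = gcd-greatest (∣m∣n⇒∣m+n (∣m⇒∣m*n c k∣a) (∣n⇒∣m*n j k∣d)) (∣n⇒∣m*n r k∣d) , k∣d

coprime-quotients : ∀ g x y x′ y′ → 1 ≤ g → gcd x y ≡ g → x ≡ g * x′ → y ≡ g * y′ → Coprime x′ y′
coprime-quotients g x y x′ y′ 1≤g gcd≡g x≡ y≡ {k} (k∣x′ , k∣y′) =
  ∣1⇒≡1 (*-cancelˡ-∣ g {{ℕ.>-nonZero 1≤g}} (subst (g * k ∣_) (trans gcd≡g (sym (*-identityʳ g)))
    (gcd-greatest (subst (g * k ∣_) (sym x≡) (*-monoʳ-∣ g k∣x′))
                  (subst (g * k ∣_) (sym y≡) (*-monoʳ-∣ g k∣y′)))))

div-exact : ∀ a b → b ∣ a → a ≡ b * (a div b)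
div-exact a zero    b∣a = 0∣⇒≡0 b∣a
div-exact a (suc b) b∣a = sym (m*[n/m]≡n b∣a)

1≤factorʳ : ∀ a {b} → 1 ≤ a * b → 1 ≤ b
1≤factorʳ a {zero}  1≤ab = contradiction (subst (1 ≤_) (*-zeroʳ a) 1≤ab) λ ()
1≤factorʳ a {suc b} _    = s≤s z≤n

-- φ B counts the residues i < B coprime to B (the residue 0 standing for B).
φ-as-∑ : ∀ B → φ B ≡ ∑ (λ i → 𝟙 (gcd i B ≟ 1)) B
φ-as-∑ B = begin
  φ B                                                          ≡⟨ length≡sum (filter (λ i → gcd i B ≟ 1) (range1 B)) ⟩
  sum (map (λ _ → 1) (filter (λ i → gcd i B ≟ 1) (range1 B)))  ≡⟨ sum-filter-range1 (λ i → gcd i B ≟ 1) (λ _ → 1) B ⟩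
  ∑ (λ i → 𝟙 (gcd (suc i) B ≟ 1)) B                            ≡⟨ sym (∑-rotate B _ gcd0≡gcdB) ⟩
  ∑ (λ i → 𝟙 (gcd i B ≟ 1)) B                                  ∎
  where
  open ≡-Reasoning
  gcd0≡gcdB : 𝟙 (gcd 0 B ≟ 1) ≡ 𝟙 (gcd B B ≟ 1)
  gcd0≡gcdB = cong (λ g → 𝟙 (g ≟ 1)) (trans (gcd-identityˡ B) (sym (gcd-self B)))

-- The residues y < m·B with gcd (y , m·B) = m are the m·i with gcd (i , B) = 1.
∑-gcd≡factor : ∀ m B → 1 ≤ m → ∑ (λ y → 𝟙 (m ≟ gcd y (m * B))) (m * B) ≡ φ B
∑-gcd≡factor m@(suc m₀) B _ = begin
  ∑ g (m * B)                          ≡⟨ cong (∑ g) (*-comm m B) ⟩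
  ∑ g (B * m)                          ≡⟨ ∑-blocks B m g ⟩
  ∑ (λ i → ∑ (λ t → g (i * m + t)) m) B ≡⟨ ∑-cong B (λ i _ → block i) ⟩
  ∑ (λ i → 𝟙 (gcd i B ≟ 1)) B          ≡⟨ sym (φ-as-∑ B) ⟩
  φ B                                  ∎
  where
  open ≡-Reasoning
  g : ℕ → ℕ
  g y = 𝟙 (m ≟ gcd y (m * B))
  multiple : ∀ i → g (i * m + 0) ≡ 𝟙 (gcd i B ≟ 1)
  multiple i = trans (cong (λ z → 𝟙 (m ≟ z)) gcd≡)
    (select-⇔ (m ≟ m * gcd i B) (gcd i B ≟ 1)
      (λ e → *-cancelˡ-≡ (gcd i B) 1 m (trans (sym e) (sym (*-identityʳ m))))
      (λ e → sym (trans (cong (m *_) e) (*-identityʳ m))))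
    where
    gcd≡ : gcd (i * m + 0) (m * B) ≡ m * gcd i B
    gcd≡ = trans (cong (λ z → gcd z (m * B)) (trans (+-identityʳ _) (*-comm i m))) (sym (c*gcd[m,n]≡gcd[cm,cn] m i B))
  -- a non-multiple y is not divisible by m, so neither is gcd (y , m·B)
  nonMultiple : ∀ i t → t < m₀ → g (i * m + suc t) ≡ 0
  nonMultiple i t t<m₀ = select-no (m ≟ gcd (i * m + suc t) (m * B)) λ m≡gcd →
    let m∣y   = subst (_∣ (i * m + suc t)) (sym m≡gcd) (gcd[m,n]∣m (i * m + suc t) (m * B))
        m∣1+t = ∣m+n∣m⇒∣n m∣y (n∣m*n i)
    in <⇒≱ (s≤s t<m₀) (∣⇒≤ m∣1+t)
  block : ∀ i → ∑ (λ t → g (i * m + t)) m ≡ 𝟙 (gcd i B ≟ 1)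
  block i = trans (cong₂ _+_ (multiple i) (∑-zero m₀ (λ t t<m₀ → nonMultiple i t t<m₀))) (+-identityʳ _)

-- An affine map j ↦ s + j·t with t coprime to C permutes the residues mod C.
∑-affine : ∀ C t s (H : ℕ → ℕ) .{{_ : NonZero C}} → Coprime C t →
  ∑ (λ j → H ((s + j * t) % C)) C ≡ ∑ H C
∑-affine C t s H C⊥t = ∑-reindex C σ H (λ j _ → m%n<n (s + j * t) C) injective
  where
  σ : ℕ → ℕ
  σ j = (s + j * t) % C
  -- σ i = σ (i + e) forces C ∣ e·t, hence C ∣ e, hence e = 0 when i + e < C
  injective≤ : ∀ i j → i ≤ j → j < C → σ i ≡ σ j → i ≡ j
  injective≤ i j i≤j j<C σi≡σj with j ∸ i in j∸i
  ... | zero  = sym (trans (sym (m+[n∸m]≡n i≤j)) (trans (cong (i +_) j∸i) (+-identityʳ i)))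
  ... | suc e = contradiction (∣⇒≤ C∣1+e) (<⇒≱ (subst (_< C) j∸i (≤-<-trans (m∸n≤m j i) j<C)))
    where
    j≡ : s + j * t ≡ s + i * t + suc e * t
    j≡ = trans (cong (λ z → s + z * t) (trans (sym (m+[n∸m]≡n i≤j)) (cong (i +_) j∸i)))
               (solve 4 (λ s i e t → s :+ (i :+ e) :* t := s :+ i :* t :+ e :* t) refl s i (suc e) t)
    C∣1+e : C ∣ suc e
    C∣1+e = coprime-divisor C⊥t (subst (C ∣_) (*-comm (suc e) t)
              (%-shift⇒∣ (s + i * t) (suc e * t) C (trans (cong (_% C) (sym j≡)) (sym σi≡σj))))
  injective : ∀ i j → i < C → j < C → σ i ≡ σ j → i ≡ j
  injective i j i<C j<C σi≡σj with ≤-total i j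
  ... | inj₁ i≤j = injective≤ i j i≤j j<C σi≡σj
  ... | inj₂ j≤i = sym (injective≤ j i j≤i i<C (sym σi≡σj))

-- The count for one divisor r = m′·A·B after dividing out δ: s, m′ and B are
-- coprime to t, and every prime of A divides t (so all that is coprime to t
-- is coprime to A).
localCount : ∀ m′ t s A B → 1 ≤ m′ → 1 ≤ B →
  Coprime s t → Coprime m′ t → Coprime B t → (∀ y → Coprime y t → Coprime y A) →
  ∑ (λ j → 𝟙 (m′ ≟ gcd (s + j * t) (m′ * (A * B) * t))) (m′ * (A * B)) ≡ A * φ B
localCount m′@(suc _) t s A B@(suc _) _ _ s⊥t m′⊥t B⊥t A-primes-divide-t = begin
  ∑ (λ j → 𝟙 (m′ ≟ gcd (s + j * t) (m′ * (A * B) * t))) (m′ * (A * B))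
    ≡⟨ ∑-cong (m′ * (A * B)) (λ j _ → cong (λ z → 𝟙 (m′ ≟ z)) (dropAt j)) ⟩
  ∑ f (m′ * (A * B))
    ≡⟨ cong (∑ f) (solve 3 (λ a b c → a :* (b :* c) := b :* (a :* c)) refl m′ A B) ⟩
  ∑ f (A * C)
    ≡⟨ ∑-periodic A C f periodic ⟩
  A * ∑ f C
    ≡⟨ cong (A *_) (∑-cong C (λ j _ → cong (λ z → 𝟙 (m′ ≟ z)) (sym (gcd-% (s + j * t) C)))) ⟩
  A * ∑ (λ j → H ((s + j * t) % C)) C
    ≡⟨ cong (A *_) (∑-affine C t s H (coprime-* m′⊥t B⊥t)) ⟩
  A * ∑ H C
    ≡⟨ cong (A *_) (∑-gcd≡factor m′ B (s≤s z≤n)) ⟩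
  A * φ B ∎
  where
  open ≡-Reasoning
  C = m′ * B
  f : ℕ → ℕ
  f j = 𝟙 (m′ ≟ gcd (s + j * t) C)
  H : ℕ → ℕ
  H y = 𝟙 (m′ ≟ gcd y C)
  y⊥t : ∀ j → Coprime (s + j * t) t
  y⊥t j {k} (k∣y , k∣t) = s⊥t (∣m+n∣m⇒∣n (subst (k ∣_) (+-comm s (j * t)) k∣y) (∣n⇒∣m*n j k∣t) , k∣t)
  -- s + j·t is coprime to A·t, which can therefore be dropped from the modulus
  dropAt : ∀ j → gcd (s + j * t) (m′ * (A * B) * t) ≡ gcd (s + j * t) C
  dropAt j = trans (cong (gcd (s + j * t)) (solve 4 (λ a b c e → a :* (b :* c) :* e := b :* e :* (a :* c)) refl m′ A B t))
    (gcd-drop-coprime (s + j * t) (A * t) C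
      (Coprime.sym (coprime-* (Coprime.sym (A-primes-divide-t _ (y⊥t j))) (Coprime.sym (y⊥t j)))))
  periodic : ∀ j → f (C + j) ≡ f j
  periodic j = cong (λ z → 𝟙 (m′ ≟ z)) (trans
    (cong (λ z → gcd z C) (solve 4 (λ s c j e → s :+ (c :+ j) :* e := s :+ j :* e :+ e :* c) refl s C j t))
    (gcd-shift (s + j * t) t C))

IsValuation : ℕ → ℕ → ℕ → Set
IsValuation p x k = p ^ k ∣ x × ¬ (p ^ suc k ∣ x)

prime≥2 : ∀ {p} → Prime p → 2 ≤ p
prime≥2 {p} p-prime = ℕ.nonTrivial⇒n>1 p {{prime⇒nonTrivial p-prime}}

vp-fuel-correct : ∀ fuel p₀ x → 1 ≤ x → x ≤ fuel →
  IsValuation (suc (suc p₀)) x (vp-fuel fuel (suc (suc p₀)) x)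
vp-fuel-correct zero p₀ x 1≤x x≤0 = contradiction (≤-trans 1≤x x≤0) λ ()
vp-fuel-correct (suc fuel) p₀ x 1≤x x≤1+fuel with suc (suc p₀) ∣? x
... | no p∤x = 1∣ x , λ p∣x → p∤x (subst (_∣ x) (*-identityʳ (suc (suc p₀))) p∣x)
... | yes p∣x = subst (λ z → p * p ^ k ∣ z) p*y≡x (*-monoʳ-∣ p (proj₁ ih))
              , λ p^2+k∣x → proj₂ ih (*-cancelˡ-∣ p (subst (λ z → p * p ^ suc k ∣ z) (sym p*y≡x) p^2+k∣x))
  where
  p = suc (suc p₀)
  y = x / p
  p*y≡x : p * y ≡ x
  p*y≡x = m*[n/m]≡n p∣x
  instance
    x≢0 : NonZero x
    x≢0 = ℕ.>-nonZero 1≤x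
  k = vp-fuel fuel p y
  ih = vp-fuel-correct fuel p₀ y (1≤factorʳ p (subst (1 ≤_) (sym p*y≡x) 1≤x))
                                 (s≤s⁻¹ (≤-trans (m/n<m x p (s≤s (s≤s z≤n))) x≤1+fuel))

v-correct : ∀ p x → 2 ≤ p → 1 ≤ x → IsValuation p x (v p x)
v-correct (suc (suc p₀)) x (s≤s (s≤s z≤n)) 1≤x = vp-fuel-correct x p₀ x 1≤x ≤-refl

^-monoʳ-∣ : ∀ p {a b} → a ≤ b → p ^ a ∣ p ^ b
^-monoʳ-∣ p {a} {b} a≤b = divides (p ^ (b ∸ a))
  (trans (cong (p ^_) (sym (m∸n+n≡m a≤b))) (^-distribˡ-+-* p (b ∸ a) a))

v-unique : ∀ p x k → 2 ≤ p → 1 ≤ x → IsValuation p x k → v p x ≡ k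
v-unique p x k 2≤p 1≤x (p^k∣x , p^1+k∤x) with v-correct p x 2≤p 1≤x | <-cmp (v p x) k
... | _                | tri≈ _ v≡k _ = v≡k
... | (_ , p^1+v∤x)    | tri< v<k _ _ = contradiction (∣-trans (^-monoʳ-∣ p v<k) p^k∣x) p^1+v∤x
... | (p^v∣x , _)      | tri> _ _ k<v = contradiction (∣-trans (^-monoʳ-∣ p k<v) p^v∣x) p^1+k∤x

v-not-dividing : ∀ q x → 2 ≤ q → 1 ≤ x → ¬ (q ∣ x) → v q x ≡ 0
v-not-dividing q x 2≤q 1≤x q∤x = v-unique q x 0 2≤q 1≤x (1∣ x , λ q∣x → q∤x (subst (_∣ x) (*-identityʳ q) q∣x))

prime-coprime : ∀ {p e} → Prime p → ¬ (p ∣ e) → Coprime p e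
prime-coprime p-prime p∤e {t} (t∣p , t∣e) with prime⇒irreducible p-prime t∣p
... | inj₁ t≡1 = t≡1
... | inj₂ refl = contradiction t∣e p∤e

distinct-primes-coprime : ∀ {q p} → Prime q → Prime p → q ≢ p → Coprime q p
distinct-primes-coprime q-prime p-prime q≢p = prime-coprime q-prime λ q∣p →
  [ (λ q≡1 → contradiction (subst (2 ≤_) q≡1 (prime≥2 q-prime)) λ { (s≤s ()) }) , q≢p ]′ (prime⇒irreducible p-prime q∣p)

v-*-same : ∀ p y → Prime p → 1 ≤ y → v p (p * y) ≡ suc (v p y)
v-*-same p y p-prime 1≤y = v-unique p (p * y) (suc (v p y)) 2≤p (*-mono-≤ (≤-trans (s≤s z≤n) 2≤p) 1≤y)
  ( *-monoʳ-∣ p (proj₁ val)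
  , λ p^2+v∣py → proj₂ val (*-cancelˡ-∣ p {{ℕ.>-nonZero (≤-trans (s≤s z≤n) 2≤p)}} p^2+v∣py))
  where
  2≤p = prime≥2 p-prime
  val = v-correct p y 2≤p 1≤y

v-*-other : ∀ q p y → Prime q → Prime p → q ≢ p → 1 ≤ y → v q (p * y) ≡ v q y
v-*-other q p y q-prime p-prime q≢p 1≤y = v-unique q (p * y) (v q y) (prime≥2 q-prime)
  (*-mono-≤ (≤-trans (s≤s z≤n) (prime≥2 p-prime)) 1≤y)
  ( ∣n⇒∣m*n p (proj₁ val)
  , λ q^1+v∣py → proj₂ val (coprime-divisor (coprime-^ (suc (v q y)) (distinct-primes-coprime q-prime p-prime q≢p)) q^1+v∣py))
  where
  val = v-correct q y (prime≥2 q-prime) 1≤y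

Π : (ℕ → ℕ) → ℕ → ℕ
Π f zero    = 1
Π f (suc n) = f 0 * Π (f ∘ suc) n

Π-cong : ∀ n {f g : ℕ → ℕ} → (∀ i → i < n → f i ≡ g i) → Π f n ≡ Π g n
Π-cong zero    eq = refl
Π-cong (suc n) eq = cong₂ _*_ (eq 0 (s≤s z≤n)) (Π-cong n (λ i i<n → eq (suc i) (s≤s i<n)))

Π-ones : ∀ n {f : ℕ → ℕ} → (∀ i → i < n → f i ≡ 1) → Π f n ≡ 1
Π-ones zero    eq = refl
Π-ones (suc n) eq = cong₂ _*_ (eq 0 (s≤s z≤n)) (Π-ones n (λ i i<n → eq (suc i) (s≤s i<n)))

Π-distrib-* : ∀ n (f g : ℕ → ℕ) → Π (λ i → f i * g i) n ≡ Π f n * Π g n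
Π-distrib-* zero    f g = refl
Π-distrib-* (suc n) f g = trans (cong (f 0 * g 0 *_) (Π-distrib-* n (f ∘ suc) (g ∘ suc))) (interchange (f 0) (g 0) _ _)
  where
  interchange : ∀ a b c e → (a * b) * (c * e) ≡ (a * c) * (b * e)
  interchange = solve 4 (λ a b c e → (a :* b) :* (c :* e) := (a :* c) :* (b :* e)) refl

Π-single : ∀ B x p → x < B → Π (λ i → select (i ≟ x) p 1) B ≡ p
Π-single (suc B) zero    p _ = trans (cong (p *_) (Π-ones B (λ i _ → select-no (suc i ≟ 0) {p} {1} λ ()))) (*-identityʳ p)
Π-single (suc B) (suc x) p (s≤s x<B) = trans (+-identityʳ _)
  (trans (Π-cong B (λ i _ → select-⇔ (suc i ≟ suc x) (i ≟ x) suc-injective (cong suc))) (Π-single B x p x<B))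

product-applyUpTo : ∀ {a} {A : Set a} (h : A → ℕ) (g : ℕ → A) n → product (map h (applyUpTo g n)) ≡ Π (h ∘ g) n
product-applyUpTo h g zero    = refl
product-applyUpTo h g (suc n) = cong (h (g 0) *_) (product-applyUpTo h (g ∘ suc) n)

primePart : ℕ → ℕ → ℕ
primePart q z = select (prime? q) (q ^ v q z) 1

primePart-* : ∀ q p y → Prime p → 1 ≤ y → primePart q (p * y) ≡ primePart q y * select (q ≟ p) p 1
primePart-* q p y p-prime 1≤y with prime? q
... | no q-composite = sym (trans (*-identityˡ _) (select-no (q ≟ p) λ { refl → q-composite p-prime }))
... | yes q-prime with q ≟ p
...   | yes refl = trans (cong (q ^_) (v-*-same q y q-prime 1≤y)) (*-comm q _)
...   | no q≢p   = trans (cong (q ^_) (v-*-other q p y q-prime p-prime q≢p 1≤y)) (sym (*-identityʳ _))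

primePart-1 : ∀ q → primePart q 1 ≡ 1
primePart-1 q with prime? q
... | no _        = refl
... | yes q-prime = cong (q ^_) (v-not-dividing q 1 (prime≥2 q-prime) ≤-refl
                      λ q∣1 → contradiction (subst (2 ≤_) (∣1⇒≡1 q∣1) (prime≥2 q-prime)) λ { (s≤s ()) })

primeParts≤ : ℕ → ℕ → ℕ
primeParts≤ B z = Π (λ i → primePart (suc i) z) B

primeParts≤-product : ∀ B ps → All Prime ps → All (_≤ B) ps → primeParts≤ B (product ps) ≡ product ps
primeParts≤-product B []       _ _ = Π-ones B (λ i _ → primePart-1 (suc i))
primeParts≤-product B (p@(suc p₀) ∷ ps) (p-prime ∷ ps-prime) (p≤B ∷ ps≤B) = begin
  primeParts≤ B (p * product ps)
    ≡⟨ Π-cong B (λ i _ → primePart-* (suc i) p (product ps) p-prime (productOfPrimes≥1 ps-prime)) ⟩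
  Π (λ i → primePart (suc i) (product ps) * select (suc i ≟ p) p 1) B
    ≡⟨ Π-distrib-* B _ _ ⟩
  primeParts≤ B (product ps) * Π (λ i → select (suc i ≟ p) p 1) B
    ≡⟨ cong₂ _*_ (primeParts≤-product B ps ps-prime ps≤B) onlyP ⟩
  product ps * p
    ≡⟨ *-comm (product ps) p ⟩
  p * product ps ∎
  where
  open ≡-Reasoning
  onlyP : Π (λ i → select (suc i ≟ p) p 1) B ≡ p
  onlyP = trans (Π-cong B (λ i _ → select-⇔ (suc i ≟ p) (i ≟ p₀) suc-injective (cong suc))) (Π-single B p₀ p p≤B)

∣product : ∀ ps → All (_∣ product ps) ps
∣product []       = []
∣product (p ∷ ps) = m∣m*n (product ps) ∷ All.map (∣n⇒∣m*n p) (∣product ps)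

product-primeDivisors : ∀ x → 1 ≤ x → product (map (λ p → p ^ v p x) (primeDivisors x)) ≡ x
product-primeDivisors x 1≤x = begin
  product (map (λ p → p ^ v p x) (primeDivisors x))
    ≡⟨ product-filter primeDivisor? (λ p → p ^ v p x) (range1 x) ⟩
  product (map (λ p → select (primeDivisor? p) (p ^ v p x) 1) (range1 x))
    ≡⟨ cong (product ∘ map _) (map-upTo suc x) ⟩
  product (map (λ p → select (primeDivisor? p) (p ^ v p x) 1) (applyUpTo suc x))
    ≡⟨ product-applyUpTo _ suc x ⟩
  Π (λ i → select (primeDivisor? (suc i)) (suc i ^ v (suc i) x) 1) x
    ≡⟨ Π-cong x (λ i _ → selectPrimeDivisor (suc i)) ⟩
  primeParts≤ x x
    ≡⟨ cong (primeParts≤ x) x≡∏ps ⟩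
  primeParts≤ x (product ps)
    ≡⟨ primeParts≤-product x ps (PrimeFactorisation.factorsPrime factorisation) ps≤x ⟩
  product ps
    ≡⟨ sym x≡∏ps ⟩
  x ∎
  where
  open ≡-Reasoning
  instance
    x≢0 : NonZero x
    x≢0 = ℕ.>-nonZero 1≤x
  primeDivisor? : (p : ℕ) → Dec (Prime p × p ∣ x)
  primeDivisor? p = prime? p ×-dec (p ∣? x)
  factorisation = factorise x
  ps = PrimeFactorisation.factors factorisation
  x≡∏ps : x ≡ product ps
  x≡∏ps = PrimeFactorisation.isFactorisation factorisation
  ps≤x : All (_≤ x) ps
  ps≤x = All.map (λ p∣∏ps → ∣⇒≤ (subst (_ ∣_) (sym x≡∏ps) p∣∏ps)) (∣product ps)
  selectPrimeDivisor : ∀ q → select (primeDivisor? q) (q ^ v q x) 1 ≡ primePart q x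
  selectPrimeDivisor q with prime? q | q ∣? x
  ... | yes q-prime | yes q∣x = select-yes (yes q-prime ×-dec yes q∣x) {q ^ v q x} {1} (q-prime , q∣x)
  ... | yes q-prime | no q∤x  = trans (select-no (yes q-prime ×-dec no q∤x) {q ^ v q x} {1} (q∤x ∘ proj₂))
                                      (sym (cong (q ^_) (v-not-dividing q x (prime≥2 q-prime) 1≤x q∤x)))
  ... | no q-composite | q∣?x = select-no (no q-composite ×-dec q∣?x) {q ^ v q x} {1} (q-composite ∘ proj₁)

product-partition : ∀ {a p} {A : Set a} {P : Pred A p} (P? : Decidable P) (f : A → ℕ) xs →
  product (map f (filter P? xs)) * product (map f (filter (¬? ∘ P?) xs)) ≡ product (map f xs)
product-partition P? f [] = refl
product-partition P? f (x ∷ xs) with P? x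
... | yes _ = trans (*-assoc (f x) _ _) (cong (f x *_) (product-partition P? f xs))
... | no _  = trans (swap (product (map f (filter P? xs))) (f x) _) (cong (f x *_) (product-partition P? f xs))
  where
  swap : ∀ a b c → a * (b * c) ≡ b * (a * c)
  swap = solve 3 (λ a b c → a :* (b :* c) := b :* (a :* c)) refl

ePart*eFreePart : ∀ k e → 1 ≤ k → ePart k e * eFreePart k e ≡ k
ePart*eFreePart k e 1≤k =
  trans (product-partition (_∣? e) (λ p → p ^ v p k) (primeDivisors k)) (product-primeDivisors k 1≤k)

coprime-product : ∀ {a} {A : Set a} e (f : A → ℕ) xs →
  All (λ x → Coprime (f x) e) xs → Coprime (product (map f xs)) e
coprime-product e f []       []           = 1-coprimeTo e
coprime-product e f (x ∷ xs) (fx⊥e ∷ rest) = coprime-* fx⊥e (coprime-product e f xs rest)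

eFreePart-coprime : ∀ k e → Coprime (eFreePart k e) e
eFreePart-coprime k e = coprime-product e (λ p → p ^ v p k) _ (All.map primePower⊥e
  (All.zip (all-filter (¬? ∘ (_∣? e)) (primeDivisors k)
         , filter⁺ (¬? ∘ (_∣? e)) (all-filter (λ p → prime? p ×-dec (p ∣? k)) (range1 k)))))
  where
  primePower⊥e : ∀ {p} → ¬ (p ∣ e) × (Prime p × p ∣ k) → Coprime (p ^ v p k) e
  primePower⊥e {p} (p∤e , p-prime , _) = coprime-^ (v p k) (prime-coprime p-prime p∤e)

-- The e-part is built from primes dividing e, so whatever is coprime to e
-- is coprime to it.
ePart-coprime : ∀ k e y → Coprime y e → Coprime y (ePart k e)
ePart-coprime k e y y⊥e = Coprime.sym (coprime-product y (λ p → p ^ v p k) _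
  (All.map primePower⊥y (all-filter (_∣? e) (primeDivisors k))))
  where
  primePower⊥y : ∀ {p} → p ∣ e → Coprime (p ^ v p k) y
  primePower⊥y {p} p∣e = coprime-^ (v p k) (Coprime.sym (coprime-∣ʳ y⊥e p∣e))

module Divisors (n m c d : ℕ) (1≤n : 1 ≤ n) (1≤m : 1 ≤ m) (m∣n : m ∣ n) (c⊥d : Coprime c d) where

  δ m′ d′ n′ : ℕ
  δ  = gcd m d
  m′ = m div δ
  d′ = d div δ
  n′ = n div δ

  1≤δ : 1 ≤ δ
  1≤δ = 1≤gcd m d 1≤m

  instance
    δ≢0 : NonZero δ
    δ≢0 = ℕ.>-nonZero 1≤δ

  m≡δm′ : m ≡ δ * m′
  m≡δm′ = div-exact m δ (gcd[m,n]∣m m d)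

  d≡δd′ : d ≡ δ * d′
  d≡δd′ = div-exact d δ (gcd[m,n]∣n m d)

  n≡δn′ : n ≡ δ * n′
  n≡δn′ = div-exact n δ (∣-trans (gcd[m,n]∣m m d) m∣n)

  m′⊥d′ : Coprime m′ d′
  m′⊥d′ = coprime-quotients δ m d m′ d′ 1≤δ refl m≡δm′ d≡δd′

  count : ℕ → ℕ
  count r = ∑ (λ j → 𝟙 (m ≟ gcd (n div r * c + j * d) (r * d))) r

  admissible? : (r : ℕ) → Dec (m′ ∣ r × gcd (n div r) d ≡ δ)
  admissible? r = (m′ ∣? r) ×-dec (gcd (n div r) d ≟ δ)

  term : ℕ → ℕ
  term r = ePart (r div m′) d′ * φ (eFreePart (r div m′) d′)

  weight : ℕ → ℕ
  weight r = select (admissible? r) (term r) 0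

  count-gcd≢δ : ∀ r → gcd (n div r) d ≢ δ → count r ≡ 0
  count-gcd≢δ r gcd≢δ = ∑-zero r λ j _ → select-no (m ≟ gcd (n div r * c + j * d) (r * d)) λ m≡gcd →
    gcd≢δ (trans (sym (gcd-gcd-coprime (n div r) c d r j c⊥d)) (cong (λ z → gcd z d) (sym m≡gcd)))

  -- Nothing is counted unless m′ ∣ r: from m ∣ r·d follows m′ ∣ r·d′, and m′ ⊥ d′.
  count-m′∤r : ∀ r → ¬ (m′ ∣ r) → count r ≡ 0
  count-m′∤r r m′∤r = ∑-zero r λ j _ → select-no (m ≟ gcd (n div r * c + j * d) (r * d)) λ m≡gcd →
    let m∣rd = subst (_∣ r * d) (sym m≡gcd) (gcd[m,n]∣n (n div r * c + j * d) (r * d))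
        rd≡  = trans (cong (r *_) d≡δd′) (solve 3 (λ r δ d → r :* (δ :* d) := δ :* (d :* r)) refl r δ d′)
    in m′∤r (coprime-divisor m′⊥d′ (*-cancelˡ-∣ δ (subst₂ _∣_ m≡δm′ rd≡ m∣rd)))

  count-reduced : ∀ r a′ → n div r ≡ δ * a′ →
    count r ≡ ∑ (λ j → 𝟙 (m′ ≟ gcd (a′ * c + j * d′) (r * d′))) r
  count-reduced r a′ a≡δa′ = ∑-cong r λ j _ → trans (cong (λ z → 𝟙 (m ≟ z)) (gcd≡ j))
    (select-⇔ (m ≟ δ * gcd (a′ * c + j * d′) (r * d′)) (m′ ≟ gcd (a′ * c + j * d′) (r * d′))
      (λ m≡ → *-cancelˡ-≡ m′ _ δ (trans (sym m≡δm′) m≡)) (λ m′≡ → trans m≡δm′ (cong (δ *_) m′≡)))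
    where
    gcd≡ : ∀ j → gcd (n div r * c + j * d) (r * d) ≡ δ * gcd (a′ * c + j * d′) (r * d′)
    gcd≡ j = trans (cong₂ gcd first second) (sym (c*gcd[m,n]≡gcd[cm,cn] δ _ _))
      where
      first : n div r * c + j * d ≡ δ * (a′ * c + j * d′)
      first = trans (cong₂ (λ x y → x * c + j * y) a≡δa′ d≡δd′)
        (solve 5 (λ δ a c j d → δ :* a :* c :+ j :* (δ :* d) := δ :* (a :* c :+ j :* d)) refl δ a′ c j d′)
      second : r * d ≡ δ * (r * d′)
      second = trans (cong (r *_) d≡δd′) (solve 3 (λ r δ d → r :* (δ :* d) := δ :* (r :* d)) refl r δ d′)

  count-admissible : ∀ r → 1 ≤ r → m′ ∣ r → gcd (n div r) d ≡ δ → count r ≡ term r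
  count-admissible r 1≤r m′∣r gcd≡δ = trans (count-reduced r a′ a≡δa′)
    (subst (λ r → ∑ (λ j → 𝟙 (m′ ≟ gcd (a′ * c + j * d′) (r * d′))) r ≡ A * φ B) (sym r≡m′AB)
      (localCount m′ d′ (a′ * c) A B 1≤m′ 1≤B s⊥d′ m′⊥d′ (eFreePart-coprime k d′) (ePart-coprime k d′)))
    where
    a′ = (n div r) div δ
    a≡δa′ : n div r ≡ δ * a′
    a≡δa′ = div-exact (n div r) δ (subst (_∣ n div r) gcd≡δ (gcd[m,n]∣m (n div r) d))
    k = r div m′
    A = ePart k d′
    B = eFreePart k d′
    1≤k : 1 ≤ k
    1≤k = 1≤factorʳ m′ (subst (1 ≤_) (div-exact r m′ m′∣r) 1≤r)
    r≡m′AB : r ≡ m′ * (A * B)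
    r≡m′AB = trans (div-exact r m′ m′∣r) (cong (m′ *_) (sym (ePart*eFreePart k d′ 1≤k)))
    1≤B : 1 ≤ B
    1≤B = 1≤factorʳ A (subst (1 ≤_) (sym (ePart*eFreePart k d′ 1≤k)) 1≤k)
    1≤m′ : 1 ≤ m′
    1≤m′ = 1≤factorʳ δ (subst (1 ≤_) m≡δm′ 1≤m)
    s⊥d′ : Coprime (a′ * c) d′
    s⊥d′ = coprime-* (coprime-quotients δ (n div r) d a′ d′ 1≤δ gcd≡δ a≡δa′ d≡δd′)
                     (coprime-∣ʳ c⊥d (divides δ d≡δd′))

  -- A divisor r of n with gcd (n/r , d) = δ divides n′: n/r is a multiple of δ.
  ∣n′ : ∀ r → r ∣ n → gcd (n div r) d ≡ δ → r ∣ n′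
  ∣n′ r r∣n gcd≡δ = divides a′ (*-cancelˡ-≡ n′ (a′ * r) δ (begin
    δ * n′             ≡⟨ sym n≡δn′ ⟩
    n                  ≡⟨ div-exact n r r∣n ⟩
    r * (n div r)      ≡⟨ cong (r *_) (div-exact (n div r) δ (subst (_∣ n div r) gcd≡δ (gcd[m,n]∣m (n div r) d))) ⟩
    r * (δ * a′)       ≡⟨ solve 3 (λ r δ a → r :* (δ :* a) := δ :* (a :* r)) refl r δ a′ ⟩
    δ * (a′ * r)       ∎))
    where
    open ≡-Reasoning
    a′ = (n div r) div δ

  inadmissible : ∀ r → ¬ (m′ ∣ r × gcd (n div r) d ≡ δ) → select (r ∣? n′) (weight r) 0 ≡ 0
  inadmissible r ¬adm = trans (cong (λ w → select (r ∣? n′) w 0) (select-no (admissible? r) ¬adm)) (select-const (r ∣? n′))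

  count-divisor : ∀ r → 1 ≤ r → r ∣ n → count r ≡ select (r ∣? n′) (weight r) 0
  count-divisor r 1≤r r∣n = byCases (m′ ∣? r) (gcd (n div r) d ≟ δ)
    where
    open ≡-Reasoning
    byCases : Dec (m′ ∣ r) → Dec (gcd (n div r) d ≡ δ) → count r ≡ select (r ∣? n′) (weight r) 0
    byCases (yes m′∣r) (yes gcd≡δ) = trans (count-admissible r 1≤r m′∣r gcd≡δ) (sym (begin
      select (r ∣? n′) (weight r) 0 ≡⟨ select-yes (r ∣? n′) (∣n′ r r∣n gcd≡δ) ⟩
      weight r                     ≡⟨ select-yes (admissible? r) (m′∣r , gcd≡δ) ⟩
      term r                       ∎))
    byCases (no m′∤r) _           = trans (count-m′∤r r m′∤r) (sym (inadmissible r (m′∤r ∘ proj₁)))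
    byCases _         (no gcd≢δ)  = trans (count-gcd≢δ r gcd≢δ) (sym (inadmissible r (gcd≢δ ∘ proj₂)))

  lhs-as-∑ : lhsCount n m c d ≡ ∑ (λ i → select (suc i ∣? n) (count (suc i)) 0) n
  lhs-as-∑ = begin
    lhsCount n m c d                                     ≡⟨ length-filter-concatMap good? pairs (divisors n) ⟩
    sum (map (λ r → length (filter good? (pairs r))) (divisors n)) ≡⟨ cong sum (map-cong count-as-length (divisors n)) ⟩
    sum (map count (divisors n))                         ≡⟨ sum-filter-range1 (_∣? n) count n ⟩
    ∑ (λ i → select (suc i ∣? n) (count (suc i)) 0) n    ∎
    where
    open ≡-Reasoning
    good? : (rj : ℕ × ℕ) → Dec (m ≡ gcd (n div proj₁ rj * c + proj₂ rj * d) (proj₁ rj * d))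
    good? (r , j) = m ≟ gcd (n div r * c + j * d) (r * d)
    pairs : ℕ → List (ℕ × ℕ)
    pairs r = map (r ,_) (upTo r)
    count-as-length : ∀ r → length (filter good? (pairs r)) ≡ count r
    count-as-length r = begin
      length (filter good? (map (r ,_) (upTo r)))             ≡⟨ cong (length ∘ filter good?) (map-upTo (r ,_) r) ⟩
      length (filter good? (applyUpTo (r ,_) r))              ≡⟨ length≡sum (filter good? (applyUpTo (r ,_) r)) ⟩
      sum (map (λ _ → 1) (filter good? (applyUpTo (r ,_) r))) ≡⟨ sum-filter good? (λ _ → 1) (applyUpTo (r ,_) r) ⟩
      sum (map (𝟙 ∘ good?) (applyUpTo (r ,_) r))             ≡⟨ sum-applyUpTo (𝟙 ∘ good?) (r ,_) r ⟩
      count r                                                 ∎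

  rhs-as-∑ : rhsSum n m c d ≡ ∑ (λ i → select (suc i ∣? n′) (weight (suc i)) 0) n′
  rhs-as-∑ = trans (sum-filter admissible? term (divisors n′)) (sum-filter-range1 (_∣? n′) weight n′)

  -- Divisors of n beyond n′ contribute nothing, and below n′ the counts
  -- match the weights divisor by divisor.
  divisor-sums : ∑ (λ i → select (suc i ∣? n) (count (suc i)) 0) n
               ≡ ∑ (λ i → select (suc i ∣? n′) (weight (suc i)) 0) n′
  divisor-sums = begin
    ∑ F n                                    ≡⟨ cong (∑ F) (sym (m+[n∸m]≡n n′≤n)) ⟩
    ∑ F (n′ + (n ∸ n′))                       ≡⟨ ∑-+ n′ (n ∸ n′) F ⟩
    ∑ F n′ + ∑ (λ i → F (n′ + i)) (n ∸ n′)   ≡⟨ cong₂ _+_ (∑-cong n′ below) (∑-zero (n ∸ n′) beyond) ⟩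
    ∑ G n′ + 0                               ≡⟨ +-identityʳ _ ⟩
    ∑ G n′                                   ∎
    where
    open ≡-Reasoning
    F G : ℕ → ℕ
    F i = select (suc i ∣? n) (count (suc i)) 0
    G i = select (suc i ∣? n′) (weight (suc i)) 0
    n′≤n : n′ ≤ n
    n′≤n = subst (n′ ≤_) (sym n≡δn′) (m≤n*m n′ δ)
    below : ∀ i → i < n′ → F i ≡ G i
    below i _ with suc i ∣? n
    ... | yes 1+i∣n = count-divisor (suc i) (s≤s z≤n) 1+i∣n
    ... | no 1+i∤n  = sym (select-no (suc i ∣? n′) λ 1+i∣n′ → 1+i∤n (∣-trans 1+i∣n′ (divides δ n≡δn′)))
    beyond : ∀ i → i < n ∸ n′ → F (n′ + i) ≡ 0
    beyond i _ with suc (n′ + i) ∣? n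
    ... | no _      = refl
    ... | yes r∣n  = trans (count-divisor (suc (n′ + i)) (s≤s z≤n) r∣n) (select-no (suc (n′ + i) ∣? n′) λ r∣n′ →
      <⇒≱ (s≤s (m≤m+n n′ i)) (∣⇒≤ {{ℕ.>-nonZero (1≤factorʳ δ (subst (1 ≤_) n≡δn′ 1≤n))}} r∣n′))

-- The theorem.
lemma2 : (n m c d : ℕ) → 1 ≤ n → 1 ≤ m → m ∣ n → c < d → gcd c d ≡ 1 →
    lhsCount n m c d ≡ rhsSum n m c d
lemma2 n m c d 1≤n 1≤m m∣n _ gcd[c,d]≡1 = begin
  lhsCount n m c d                                       ≡⟨ lhs-as-∑ ⟩
  ∑ (λ i → select (suc i ∣? n) (count (suc i)) 0) n      ≡⟨ divisor-sums ⟩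
  ∑ (λ i → select (suc i ∣? n′) (weight (suc i)) 0) n′   ≡⟨ sym rhs-as-∑ ⟩
  rhsSum n m c d                                         ∎
  where
  open ≡-Reasoning
  open Divisors n m c d 1≤n 1≤m m∣n (gcd≡1⇒coprime gcd[c,d]≡1)
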